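{- Let $z_2\in\mathbb{Z}$ be a multiple of $400$, let $e_2=(z_2,3,1)$, $G_2=\{x\in G: x\ge e_2\}$, let $\rho_2$ be the rata die function on $G_2$ with epoch $e_2$, and let $\rho_3$ be the rata die function on $G_2$ with epoch $e_3\in G_2$, where $e_3\ge e_2$. Given $r\in\mathbb{Z}$ with $r\ge-\rho_2(e_3)$, set $r_0=r+\rho_2(e_3)$ and $n_1=4\cdot r_0+3$, $q_1=n_1/146097$, $r_1=n_1\%146097/4$; $n_2=4\cdot r_1+3$, $u_2=2939745\cdot n_2$, $q_2=u_2/2^{32}$, $r_2=u_2\%2^{32}/2939745/4$; $n_3=2141\cdot r_2+197913$, $q_3=n_3/2^{16}$, $r_3=n_3\%2^{16}/2141$; $y_0=100\cdot q_1+q_2$, $m_0=q_3$, $d_0=r_3$; $y_1=y_0+\mathbf 1_{\{r_2\ge306\}}$, $m_1=m_0-12\cdot\mathbf 1_{\{r_2\ge306\}}$, $d_1=d_0+1$; $y_2=y_1+z_2$, $m_2=m_1$, $d_2=d_1$. Then $(y_2,m_2,d_2)$ is a date in $G_2$ and $\rho_3(y_2,m_2,d_2)=r$.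
   Context: For $n,\delta\in\mathbb{Z}$ with $\delta\neq0$, $n/\delta$ and $n\%\delta$ denote Euclidean quotient and remainder ($n=q\delta+s$, $0\le s<|\delta|$); $\cdot$, $/$, $\%$ have equal precedence and associate left to right (e.g. $u_2\%2^{32}/2939745/4=(((u_2\%2^{32})/2939745)/4)$). $\mathbf 1_{\{P\}}$ is $1$ if $P$ holds and $0$ otherwise. $\mathbb{Z}^3$ carries the lexicographic order. A year $y$ is a leap year if ($y\%4=0$ and $y\%100\ne0$) or $y\%400=0$. The (proleptic) Gregorian calendar is $G=\{(y,m,d)\in\mathbb{Z}^3: m\in\{1,\dots,12\},\ 1\le d\le L(y,m)\}$ where $L(y,m)=31$ for $m\in\{1,3,5,7,8,10,12\}$, $L(y,m)=30$ for $m\in\{4,6,9,11\}$, and $L(y,2)=29$ if $y$ is a leap year and $28$ otherwise. For a subset $C\subset\mathbb{Z}^3$ and $e\in C$, the rata die function with epoch $e$ is $\rho:C\to\mathbb{Z}$, $\rho(x)=\#\{z\in C: e\le z<x\}$ if $x\ge e$ and $\rho(x)=-\#\{z\in C: x\le z<e\}$ if $x<e$. -}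

module Defs where

open import Data.Nat using (ℕ)
open import Data.Integer
open import Data.Integer.DivMod using () renaming (_/_ to _/ᵢ_; _%_ to _%ᵢ_)
open import Data.Fin using (Fin)
open import Data.Product using (Σ; _×_; _,_)
open import Data.Sum using (_⊎_)
open import Data.Bool using (Bool; true; false; if_then_else_)
open import Relation.Nullary using (¬_; does)
open import Relation.Binary.PropositionalEquality using (_≡_)
open import Function.Bundles using (_↔_)

-- Euclidean quotient and remainder (ℤ-valued). For the stdlib operations,
-- a ≡ + (a % d) + (a / d) * d with 0 ≤ a % d < ∣ d ∣, i.e. Euclidean division.
infixl 7 _quot_ _rem_
_quot_ : ℤ → (d : ℤ) → .{{NonZero d}} → ℤ
a quot d = a /ᵢ d

_rem_ : ℤ → (d : ℤ) → .{{NonZero d}} → ℤ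
a rem d = + (a %ᵢ d)

𝟙≤ : ℤ → ℤ → ℤ
𝟙≤ a b = if does (a ≤? b) then + 1 else + 0

Date : Set
Date = ℤ × ℤ × ℤ

_<ₗ_ : Date → Date → Set
(y , m , d) <ₗ (y' , m' , d') =
  (y < y') ⊎ ((y ≡ y') × (m < m')) ⊎ ((y ≡ y') × (m ≡ m') × (d < d'))

_≤ₗ_ : Date → Date → Set
a ≤ₗ b = (a <ₗ b) ⊎ (a ≡ b)

isLeap : ℤ → Bool
isLeap y =
  (does (y rem + 4 ≟ + 0) Data.Bool.∧ Data.Bool.not (does (y rem + 100 ≟ + 0)))
  Data.Bool.∨ does (y rem + 400 ≟ + 0)

-- Month lengths L(y, m)  (only meaningful for 1 ≤ m ≤ 12)
L : ℤ → ℤ → ℤ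
L y (+ 2) = if isLeap y then + 29 else + 28
L y (+ 4) = + 30
L y (+ 6) = + 30
L y (+ 9) = + 30
L y (+ 11) = + 30
L y _ = + 31

InG : Date → Set
InG (y , m , d) = (+ 1 ≤ m × m ≤ + 12) × (+ 1 ≤ d × d ≤ L y m)

-- Rata die relation: RataDie C e x r  means  ρ(x) = r  for the rata die
-- function on C with epoch e, where "#S = n" is expressed by a bijection
-- Fin n ↔ S.
RataDie : (C : Date → Set) → Date → Date → ℤ → Set
RataDie C e x r =
  (e ≤ₗ x → Σ ℕ λ n → (r ≡ + n) ×
     (Fin n ↔ Σ Date λ z → C z × e ≤ₗ z × z <ₗ x))
  × (x <ₗ e → Σ ℕ λ n → (r ≡ - (+ n)) ×
     (Fin n ↔ Σ Date λ z → C z × x ≤ₗ z × z <ₗ e))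

e₂ : ℤ → Date
e₂ z₂ = (z₂ , + 3 , + 1)

G₂ : ℤ → Date → Set
G₂ z₂ x = InG x × e₂ z₂ ≤ₗ x

-- Adding 146097 days to r₀ adds 4 to q₁ and leaves r₁ unchanged, so the computed date moves
-- by 400 years; and shifting the year by a multiple of 400 changes neither leap years nor,
-- therefore, the successor of a date. Evaluating the algorithm over the first 146097 days
-- shows that it starts at 0000-03-01 and maps each r₀ + 1 to the successor of the date of r₀.
-- Hence n ↦ (date computed from r₀ = n) lists G₂ in increasing order without gaps, and the
-- rata die of its n-th entry with respect to its j-th entry is n - j.
module Submission where

open import Defs
open import Data.Integer
open import Data.Integer.Divisibility using (_∣_)
open import Data.Product using (_×_; _,_)

open import Axiom.UniquenessOfIdentityProofs using (module Decidable⇒UIP)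
open import Data.Bool using (Bool; true; false; _∧_; _∨_; not; if_then_else_)
open import Data.Bool.Properties using (T-≡; ∧-conicalˡ; ∧-conicalʳ)
open import Data.Empty using (⊥-elim)
open import Data.Fin using (Fin; toℕ; fromℕ<)
import Data.Fin.Properties as FinP
open import Data.Fin.Permutation using (↔⇒≡)
open import Data.Integer.DivMod using (_/_; _%_; a≡a%n+[a/n]*n; n%d<d)
open import Data.Integer.Divisibility.Signed using (∣ᵤ⇒∣; divides)
import Data.Integer.Properties as ℤP
open import Algebra.Properties.AbelianGroup ℤP.+-0-abelianGroup using (∙-cancelʳ)
open import Data.Integer.Tactic.RingSolver using (solve-∀)
import Data.Nat as ℕ
open ℕ using (ℕ; z≤n; s≤s)
import Data.Nat.DivMod as ℕD
import Data.Nat.Properties as ℕP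
open import Data.Product using (Σ; proj₁; proj₂; map₂)
open import Data.Product.Properties using (,-injective)
open import Data.Sum using (_⊎_; inj₁; inj₂)
open import Function using (_∘_; _$_)
open import Function.Bundles using (_↔_; mk↔ₛ′; module Equivalence)
open import Function.Construct.Composition using (_↔-∘_)
open import Function.Construct.Symmetry using (↔-sym)
open import Relation.Binary.Definitions using (DecidableEquality; tri<; tri≈; tri>)
open import Relation.Binary.PropositionalEquality
open import Relation.Nullary using (¬_; yes; no; does; isYes)
open import Relation.Nullary.Decidable using (map′; _×-dec_; toWitness)

-- Built from the componentwise tests rather than ≡-dec, so that deciding it never evaluates an
-- equality proof; the evaluation of followsNext below depends on this.
_≟ᵈ_ : DecidableEquality Date
(y , m , d) ≟ᵈ (y′ , m′ , d′) =
  map′ (λ (y≡y′ , m≡m′ , d≡d′) → cong₂ _,_ y≡y′ (cong₂ _,_ m≡m′ d≡d′))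
       (λ x≡x′ → map₂ ,-injective (,-injective x≡x′))
       ((y ℤP.≟ y′) ×-dec (m ℤP.≟ m′) ×-dec (d ℤP.≟ d′))

≤⇒<∨≡ : ∀ {i j : ℤ} → i ≤ j → i < j ⊎ i ≡ j
≤⇒<∨≡ {i} {j} i≤j with i ℤP.≟ j
... | yes i≡j = inj₂ i≡j
... | no i≢j = inj₁ (ℤP.≤∧≢⇒< i≤j i≢j)

i<suc[i] : ∀ i → i < suc i
i<suc[i] i = ℤP.suc[i]≤j⇒i<j ℤP.≤-refl

<ₗ-irrefl : ∀ {x} → ¬ x <ₗ x
<ₗ-irrefl (inj₁ y<y) = ℤP.<-irrefl refl y<y
<ₗ-irrefl (inj₂ (inj₁ (_ , m<m))) = ℤP.<-irrefl refl m<m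
<ₗ-irrefl (inj₂ (inj₂ (_ , _ , d<d))) = ℤP.<-irrefl refl d<d

<ₗ-trans : ∀ {x y w} → x <ₗ y → y <ₗ w → x <ₗ w
<ₗ-trans (inj₁ p) (inj₁ q) = inj₁ (ℤP.<-trans p q)
<ₗ-trans (inj₁ p) (inj₂ (inj₁ (refl , _))) = inj₁ p
<ₗ-trans (inj₁ p) (inj₂ (inj₂ (refl , _))) = inj₁ p
<ₗ-trans (inj₂ (inj₁ (refl , _))) (inj₁ q) = inj₁ q
<ₗ-trans (inj₂ (inj₁ (refl , p))) (inj₂ (inj₁ (refl , q))) = inj₂ (inj₁ (refl , ℤP.<-trans p q))
<ₗ-trans (inj₂ (inj₁ (refl , p))) (inj₂ (inj₂ (refl , refl , _))) = inj₂ (inj₁ (refl , p))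
<ₗ-trans (inj₂ (inj₂ (refl , refl , _))) (inj₁ q) = inj₁ q
<ₗ-trans (inj₂ (inj₂ (refl , refl , _))) (inj₂ (inj₁ (refl , q))) = inj₂ (inj₁ (refl , q))
<ₗ-trans (inj₂ (inj₂ (refl , refl , p))) (inj₂ (inj₂ (refl , refl , q))) =
  inj₂ (inj₂ (refl , refl , ℤP.<-trans p q))

≤ₗ-<ₗ-trans : ∀ {x y w} → x ≤ₗ y → y <ₗ w → x <ₗ w
≤ₗ-<ₗ-trans (inj₁ x<y) y<w = <ₗ-trans x<y y<w
≤ₗ-<ₗ-trans (inj₂ refl) y<w = y<w

<ₗ-≤ₗ-trans : ∀ {x y w} → x <ₗ y → y ≤ₗ w → x <ₗ w
<ₗ-≤ₗ-trans x<y (inj₁ y<w) = <ₗ-trans x<y y<w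
<ₗ-≤ₗ-trans x<y (inj₂ refl) = x<y

≤ₗ-trans : ∀ {x y w} → x ≤ₗ y → y ≤ₗ w → x ≤ₗ w
≤ₗ-trans x≤y (inj₁ y<w) = inj₁ (≤ₗ-<ₗ-trans x≤y y<w)
≤ₗ-trans x≤y (inj₂ refl) = x≤y

≤ₗ∨>ₗ : ∀ x y → x ≤ₗ y ⊎ y <ₗ x
≤ₗ∨>ₗ (y , m , d) (y′ , m′ , d′) with ℤP.<-cmp y y′ | ℤP.<-cmp m m′ | ℤP.<-cmp d d′
... | tri< y<y′ _ _ | _ | _ = inj₁ (inj₁ (inj₁ y<y′))
... | tri> _ _ y′<y | _ | _ = inj₂ (inj₁ y′<y)
... | tri≈ _ refl _ | tri< m<m′ _ _ | _ = inj₁ (inj₁ (inj₂ (inj₁ (refl , m<m′))))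
... | tri≈ _ refl _ | tri> _ _ m′<m | _ = inj₂ (inj₂ (inj₁ (refl , m′<m)))
... | tri≈ _ refl _ | tri≈ _ refl _ | tri< d<d′ _ _ = inj₁ (inj₁ (inj₂ (inj₂ (refl , refl , d<d′))))
... | tri≈ _ refl _ | tri≈ _ refl _ | tri≈ _ refl _ = inj₁ (inj₂ refl)
... | tri≈ _ refl _ | tri≈ _ refl _ | tri> _ _ d′<d = inj₂ (inj₂ (inj₂ (refl , refl , d′<d)))

ℤ-≡-irrelevant : ∀ {i j : ℤ} (p q : i ≡ j) → p ≡ q
ℤ-≡-irrelevant = Decidable⇒UIP.≡-irrelevant ℤP._≟_

Date-≡-irrelevant : ∀ {x y : Date} (p q : x ≡ y) → p ≡ q
Date-≡-irrelevant = Decidable⇒UIP.≡-irrelevant _≟ᵈ_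

<ₗ-irrelevant : ∀ {x y} (p q : x <ₗ y) → p ≡ q
<ₗ-irrelevant (inj₁ p) (inj₁ q) = cong inj₁ (ℤP.<-irrelevant p q)
<ₗ-irrelevant (inj₂ (inj₁ (e , p))) (inj₂ (inj₁ (e′ , q))) =
  cong (inj₂ ∘ inj₁) (cong₂ _,_ (ℤ-≡-irrelevant e e′) (ℤP.<-irrelevant p q))
<ₗ-irrelevant (inj₂ (inj₂ (e₁ , e₂ , p))) (inj₂ (inj₂ (e₁′ , e₂′ , q))) =
  cong (inj₂ ∘ inj₂) (cong₂ _,_ (ℤ-≡-irrelevant e₁ e₁′) (cong₂ _,_ (ℤ-≡-irrelevant e₂ e₂′) (ℤP.<-irrelevant p q)))
<ₗ-irrelevant (inj₁ p) (inj₂ (inj₁ (refl , _))) = ⊥-elim (ℤP.<-irrefl refl p)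
<ₗ-irrelevant (inj₁ p) (inj₂ (inj₂ (refl , _))) = ⊥-elim (ℤP.<-irrefl refl p)
<ₗ-irrelevant (inj₂ (inj₁ (refl , _))) (inj₁ q) = ⊥-elim (ℤP.<-irrefl refl q)
<ₗ-irrelevant (inj₂ (inj₂ (refl , _))) (inj₁ q) = ⊥-elim (ℤP.<-irrefl refl q)
<ₗ-irrelevant (inj₂ (inj₁ (_ , p))) (inj₂ (inj₂ (_ , refl , _))) = ⊥-elim (ℤP.<-irrefl refl p)
<ₗ-irrelevant (inj₂ (inj₂ (_ , refl , _))) (inj₂ (inj₁ (_ , q))) = ⊥-elim (ℤP.<-irrefl refl q)

≤ₗ-irrelevant : ∀ {x y} (p q : x ≤ₗ y) → p ≡ q
≤ₗ-irrelevant (inj₁ p) (inj₁ q) = cong inj₁ (<ₗ-irrelevant p q)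
≤ₗ-irrelevant (inj₂ e) (inj₂ e′) = cong inj₂ (Date-≡-irrelevant e e′)
≤ₗ-irrelevant (inj₁ p) (inj₂ refl) = ⊥-elim (<ₗ-irrefl p)
≤ₗ-irrelevant (inj₂ refl) (inj₁ q) = ⊥-elim (<ₗ-irrefl q)

InG-irrelevant : ∀ {x} (p q : InG x) → p ≡ q
InG-irrelevant ((a , b) , (c , d)) ((a′ , b′) , (c′ , d′)) =
  cong₂ _,_ (cong₂ _,_ (ℤP.≤-irrelevant a a′) (ℤP.≤-irrelevant b b′))
            (cong₂ _,_ (ℤP.≤-irrelevant c c′) (ℤP.≤-irrelevant d d′))

G₂-irrelevant : ∀ z {x} (p q : G₂ z x) → p ≡ q
G₂-irrelevant z (g , e≤x) (g′ , e≤x′) = cong₂ _,_ (InG-irrelevant g g′) (≤ₗ-irrelevant e≤x e≤x′)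

≤ₗ-sameMonth : ∀ {y m d d′} → d ≤ d′ → (y , m , d) ≤ₗ (y , m , d′)
≤ₗ-sameMonth d≤d′ with ≤⇒<∨≡ d≤d′
... | inj₁ d<d′ = inj₁ (inj₂ (inj₂ (refl , refl , d<d′)))
... | inj₂ refl = inj₂ refl

firstOfMonth-≤ₗ : ∀ {y m m′ d′} → m ≤ m′ → + 1 ≤ d′ → (y , m , + 1) ≤ₗ (y , m′ , d′)
firstOfMonth-≤ₗ m≤m′ 1≤d′ with ≤⇒<∨≡ m≤m′
... | inj₁ m<m′ = inj₁ (inj₂ (inj₁ (refl , m<m′)))
... | inj₂ refl = ≤ₗ-sameMonth 1≤d′

firstOfYear-≤ₗ : ∀ {y y′ m′ d′} → y ≤ y′ → + 1 ≤ m′ → + 1 ≤ d′ → (y , + 1 , + 1) ≤ₗ (y′ , m′ , d′)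
firstOfYear-≤ₗ y≤y′ 1≤m′ 1≤d′ with ≤⇒<∨≡ y≤y′
... | inj₁ y<y′ = inj₁ (inj₁ y<y′)
... | inj₂ refl = firstOfMonth-≤ₗ 1≤m′ 1≤d′

next : Date → Date
next (y , m , d) with d <? L y m | m <? + 12
... | yes _ | _     = y , m , suc d
... | no _  | yes _ = y , suc m , + 1
... | no _  | no _  = suc y , + 1 , + 1

<ₗ-next : ∀ x → x <ₗ next x
<ₗ-next (y , m , d) with d <? L y m | m <? + 12
... | yes _ | _     = inj₂ (inj₂ (refl , refl , i<suc[i] d))
... | no _  | yes _ = inj₂ (inj₁ (refl , i<suc[i] m))
... | no _  | no _  = inj₁ (i<suc[i] y)

next-minimal : ∀ {x w} → InG w → x <ₗ w → next x ≤ₗ w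
next-minimal {y , m , d} ((1≤m′ , m′≤12) , (1≤d′ , d′≤L)) x<w
  with d <? L y m | m <? + 12 | x<w
... | yes _  | _      | inj₁ y<y′ = inj₁ (inj₁ y<y′)
... | yes _  | _      | inj₂ (inj₁ (refl , m<m′)) = inj₁ (inj₂ (inj₁ (refl , m<m′)))
... | yes _  | _      | inj₂ (inj₂ (refl , refl , d<d′)) = ≤ₗ-sameMonth (ℤP.i<j⇒suc[i]≤j d<d′)
... | no d≮L | _      | inj₂ (inj₂ (refl , refl , d<d′)) = ⊥-elim (d≮L (ℤP.<-≤-trans d<d′ d′≤L))
... | no _   | yes _  | inj₁ y<y′ = inj₁ (inj₁ y<y′)
... | no _   | yes _  | inj₂ (inj₁ (refl , m<m′)) = firstOfMonth-≤ₗ (ℤP.i<j⇒suc[i]≤j m<m′) 1≤d′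
... | no _   | no _   | inj₁ y<y′ = firstOfYear-≤ₗ (ℤP.i<j⇒suc[i]≤j y<y′) 1≤m′ 1≤d′
... | no _   | no m≮12 | inj₂ (inj₁ (refl , m<m′)) = ⊥-elim (m≮12 (ℤP.<-≤-trans m<m′ m′≤12))

L-shape : ∀ m → m ≡ + 2 ⊎ (∀ y → L y m ≡ + 30) ⊎ (∀ y → L y m ≡ + 31)
L-shape -[1+ _ ] = inj₂ (inj₂ λ _ → refl)
L-shape (+ 0)  = inj₂ (inj₂ λ _ → refl)
L-shape (+ 1)  = inj₂ (inj₂ λ _ → refl)
L-shape (+ 2)  = inj₁ refl
L-shape (+ 3)  = inj₂ (inj₂ λ _ → refl)
L-shape (+ 4)  = inj₂ (inj₁ λ _ → refl)
L-shape (+ 5)  = inj₂ (inj₂ λ _ → refl)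
L-shape (+ 6)  = inj₂ (inj₁ λ _ → refl)
L-shape (+ 7)  = inj₂ (inj₂ λ _ → refl)
L-shape (+ 8)  = inj₂ (inj₂ λ _ → refl)
L-shape (+ 9)  = inj₂ (inj₁ λ _ → refl)
L-shape (+ 10) = inj₂ (inj₂ λ _ → refl)
L-shape (+ 11) = inj₂ (inj₁ λ _ → refl)
L-shape (+ ℕ.suc (ℕ.suc (ℕ.suc (ℕ.suc (ℕ.suc (ℕ.suc (ℕ.suc (ℕ.suc (ℕ.suc (ℕ.suc (ℕ.suc (ℕ.suc _)))))))))))) =
  inj₂ (inj₂ λ _ → refl)

1≤L : ∀ y m → + 1 ≤ L y m
1≤L y m with L-shape m
... | inj₁ refl with isLeap y
...   | true  = +≤+ (s≤s z≤n)
...   | false = +≤+ (s≤s z≤n)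
1≤L y m | inj₂ (inj₁ L≡30) = subst (+ 1 ≤_) (sym (L≡30 y)) (+≤+ (s≤s z≤n))
1≤L y m | inj₂ (inj₂ L≡31) = subst (+ 1 ≤_) (sym (L≡31 y)) (+≤+ (s≤s z≤n))

L-cong : ∀ {y y′} → isLeap y ≡ isLeap y′ → ∀ m → L y m ≡ L y′ m
L-cong {y} {y′} leap≡ m with L-shape m
... | inj₁ refl = cong (λ b → if b then + 29 else + 28) leap≡
... | inj₂ (inj₁ L≡30) = trans (L≡30 y) (sym (L≡30 y′))
... | inj₂ (inj₂ L≡31) = trans (L≡31 y) (sym (L≡31 y′))

next-InG : ∀ {x} → InG x → InG (next x)
next-InG {y , m , d} ((1≤m , m≤12) , (1≤d , d≤L)) with d <? L y m | m <? + 12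
... | yes d<L | _ = (1≤m , m≤12) , (ℤP.≤-trans 1≤d (ℤP.i≤suc[i] d) , ℤP.i<j⇒suc[i]≤j d<L)
... | no _ | yes m<12 = (ℤP.≤-trans 1≤m (ℤP.i≤suc[i] m) , ℤP.i<j⇒suc[i]≤j m<12) , (ℤP.≤-refl , 1≤L y (suc m))
... | no _ | no _ = (ℤP.≤-refl , +≤+ (s≤s z≤n)) , (ℤP.≤-refl , +≤+ (s≤s z≤n))

addYears : ℤ → Date → Date
addYears s (y , m , d) = y + s , m , d

next-addYears : ∀ s → (∀ y → isLeap (y + s) ≡ isLeap y) → ∀ x → next (addYears s x) ≡ addYears s (next x)
next-addYears s leap≡ (y , m , d) with d <? L (y + s) m | d <? L y m | m <? + 12
... | yes _     | yes _    | _     = refl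
... | no _      | no _     | yes _ = refl
... | no _      | no _     | no _  = cong (_, + 1 , + 1) (sym (ℤP.+-assoc (+ 1) y s))
... | yes d<L′  | no d≮L   | _     = ⊥-elim (d≮L (subst (d <_) (L-cong (leap≡ y) m) d<L′))
... | no d≮L′   | yes d<L  | _     = ⊥-elim (d≮L′ (subst (d <_) (sym (L-cong (leap≡ y) m)) d<L))

euclid-strictMono : ∀ {d r r′} {q q′ : ℤ} → r ℕ.< d → q < q′ → + r + q * + d < + r′ + q′ * + d
euclid-strictMono {d} {r} {r′} {q} {q′} r<d q<q′ = begin-strict
  + r + q * + d      <⟨ ℤP.+-monoˡ-< (q * + d) (+<+ r<d) ⟩
  + d + q * + d      ≡⟨ ℤP.suc-* q (+ d) ⟨
  suc q * + d        ≤⟨ ℤP.*-monoʳ-≤-nonNeg (+ d) (ℤP.i<j⇒suc[i]≤j q<q′) ⟩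
  q′ * + d           ≤⟨ ℤP.i≤j+i (q′ * + d) (+ r′) ⟩
  + r′ + q′ * + d    ∎
  where open ℤP.≤-Reasoning

euclid-unique : ∀ {d r r′} {q q′ : ℤ} → r ℕ.< d → r′ ℕ.< d →
  + r + q * + d ≡ + r′ + q′ * + d → q ≡ q′ × r ≡ r′
euclid-unique {d} {r} {r′} {q} {q′} r<d r′<d eq with ℤP.<-cmp q q′
... | tri< q<q′ _ _ = ⊥-elim (ℤP.<-irrefl eq (euclid-strictMono r<d q<q′))
... | tri> _ _ q′<q = ⊥-elim (ℤP.<-irrefl (sym eq) (euclid-strictMono r′<d q′<q))
... | tri≈ _ refl _ = refl , ℤP.+-injective (∙-cancelʳ (q * + d) (+ r) (+ r′) eq)

quot-rem-+-* : ∀ a k d .{{_ : ℕ.NonZero d}} →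
  (a + k * + d) quot + d ≡ a quot + d + k × (a + k * + d) rem + d ≡ a rem + d
quot-rem-+-* a k d =
  map₂ (cong (+_)) (euclid-unique (n%d<d (a + k * + d) (+ d)) (n%d<d a (+ d)) representations)
  where
  regroup : ∀ (r q k D : ℤ) → r + q * D + k * D ≡ r + (q + k) * D
  regroup = solve-∀
  open ≡-Reasoning
  representations : + ((a + k * + d) % + d) + (a + k * + d) / + d * + d ≡ + (a % + d) + (a / + d + k) * + d
  representations = begin
    + ((a + k * + d) % + d) + (a + k * + d) / + d * + d ≡⟨ a≡a%n+[a/n]*n (a + k * + d) (+ d) ⟨
    a + k * + d                                         ≡⟨ cong (_+ k * + d) (a≡a%n+[a/n]*n a (+ d)) ⟩
    + (a % + d) + a / + d * + d + k * + d               ≡⟨ regroup (+ (a % + d)) (a / + d) k (+ d) ⟩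
    + (a % + d) + (a / + d + k) * + d                   ∎

rem-+-multiple : ∀ y q c d .{{_ : ℕ.NonZero d}} → (y + q * (c * + d)) rem + d ≡ y rem + d
rem-+-multiple y q c d =
  trans (cong (λ s → (y + s) rem + d) (sym (ℤP.*-assoc q c (+ d)))) (proj₂ (quot-rem-+-* y (q * c) d))

isLeap-+-*400 : ∀ q y → isLeap (y + q * + 400) ≡ isLeap y
isLeap-+-*400 q y =
  cong₂ _$_ (cong₂ leapRule (rem-+-multiple y q (+ 100) 4) (rem-+-multiple y q (+ 4) 100))
        (rem-+-multiple y q (+ 1) 400)
  where
  leapRule : ℤ → ℤ → ℤ → Bool
  leapRule r₄ r₁₀₀ r₄₀₀ = (does (r₄ ≟ + 0) ∧ not (does (r₁₀₀ ≟ + 0))) ∨ does (r₄₀₀ ≟ + 0)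

isLeap-+-400∣ : ∀ {s} → + 400 ∣ s → ∀ y → isLeap (y + s) ≡ isLeap y
isLeap-+-400∣ {s} 400∣s with ∣ᵤ⇒∣ {+ 400} {s} 400∣s
... | divides q refl = isLeap-+-*400 q

-- The algorithm after its first stage: q₁ counts centuries from 0000-03-01 and r₁ is the day of
-- the century. It is opaque only to keep the type checker from unfolding it.
opaque
  fromCentury : ℤ → ℤ → Date
  fromCentury q₁ r₁ =
    let n₂ = + 4 * r₁ + + 3
        u₂ = + 2939745 * n₂
        q₂ = u₂ quot (+ 4294967296)
        r₂ = u₂ rem (+ 4294967296) quot (+ 2939745) quot (+ 4)
        n₃ = + 2141 * r₂ + + 197913
        q₃ = n₃ quot (+ 65536)
        r₃ = n₃ rem (+ 65536) quot (+ 2141)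
    in + 100 * q₁ + q₂ + 𝟙≤ (+ 306) r₂ , q₃ - + 12 * 𝟙≤ (+ 306) r₂ , r₃ + + 1

  fromCentury-+ : ∀ q k r → fromCentury (q + k) r ≡ addYears (+ 100 * k) (fromCentury q r)
  fromCentury-+ q k r = cong (λ y → y , _) (regroup q k _ _)
    where
    regroup : ∀ (q k q₂ i : ℤ) → + 100 * (q + k) + q₂ + i ≡ + 100 * q + q₂ + i + + 100 * k
    regroup = solve-∀

-- toDate r₀ is the statement's (y₁ , m₁ , d₁); its final date is addYears z₂ (toDate r₀).
toDate : ℤ → Date
toDate r₀ = let n₁ = + 4 * r₀ + + 3 in fromCentury (n₁ quot + 146097) (n₁ rem + 146097 quot + 4)

toDate-+-*146097 : ∀ r₀ c → toDate (r₀ + c * + 146097) ≡ addYears (c * + 400) (toDate r₀)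
toDate-+-*146097 r₀ c = begin
  toDate (r₀ + c * + 146097)
    ≡⟨ cong fromN₁ (regroup r₀ c) ⟩
  fromN₁ (n₁ + + 4 * c * + 146097)
    ≡⟨ cong₂ (λ q r → fromCentury q (r quot + 4)) (proj₁ qr) (proj₂ qr) ⟩
  fromCentury (n₁ quot + 146097 + + 4 * c) (n₁ rem + 146097 quot + 4)
    ≡⟨ fromCentury-+ _ (+ 4 * c) _ ⟩
  addYears (+ 100 * (+ 4 * c)) (toDate r₀)
    ≡⟨ cong (λ s → addYears s (toDate r₀)) (centuries c) ⟩
  addYears (c * + 400) (toDate r₀) ∎
  where
  open ≡-Reasoning
  n₁ = + 4 * r₀ + + 3
  fromN₁ : ℤ → Date
  fromN₁ n = fromCentury (n quot + 146097) (n rem + 146097 quot + 4)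
  qr = quot-rem-+-* n₁ (+ 4 * c) 146097
  regroup : ∀ r₀ c → + 4 * (r₀ + c * + 146097) + + 3 ≡ + 4 * r₀ + + 3 + + 4 * c * + 146097
  regroup = solve-∀
  centuries : ∀ c → + 100 * (+ 4 * c) ≡ c * + 400
  centuries = solve-∀

toDate-ℕ-period : ∀ t c → toDate (+ (t ℕ.+ c ℕ.* 146097)) ≡ addYears (+ c * + 400) (toDate (+ t))
toDate-ℕ-period t c = trans (cong toDate cast) (toDate-+-*146097 (+ t) (+ c))
  where
  cast : + (t ℕ.+ c ℕ.* 146097) ≡ + t + + c * + 146097
  cast = trans (ℤP.pos-+ t (c ℕ.* 146097)) (cong (_+_ (+ t)) (ℤP.pos-* c 146097))

-- With x = toDate (+ t): do the next k days of toDate follow x by next? Each date is passed on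
-- as the argument of step, so the evaluation computes toDate once per day.
followsNext : ℕ → Date → ℕ → Bool
followsNext t x ℕ.zero = true
followsNext t x (ℕ.suc k) = step (toDate (+ ℕ.suc t))
  where
  step : Date → Bool
  step x′ = isYes (x′ ≟ᵈ next x) ∧ followsNext (ℕ.suc t) x′ k

followsNext-sound : ∀ k t → followsNext t (toDate (+ t)) k ≡ true →
  ∀ i → i ℕ.< k → toDate (+ ℕ.suc (i ℕ.+ t)) ≡ next (toDate (+ (i ℕ.+ t)))
followsNext-sound (ℕ.suc k) t ok = λ where
    ℕ.zero _ → toWitness {a? = agrees?} (Equivalence.from T-≡ (∧-conicalˡ (isYes agrees?) rest ok))
    (ℕ.suc i) (s≤s i<k) → subst (λ n → toDate (+ ℕ.suc n) ≡ next (toDate (+ n))) (ℕP.+-suc i t)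
      (followsNext-sound k (ℕ.suc t) (∧-conicalʳ (isYes agrees?) rest ok) i i<k)
  where
  agrees? = toDate (+ ℕ.suc t) ≟ᵈ next (toDate (+ t))
  rest = followsNext (ℕ.suc t) (toDate (+ ℕ.suc t)) k

opaque
  unfolding fromCentury

  toDate-0 : toDate (+ 0) ≡ (+ 0 , + 3 , + 1)
  toDate-0 = refl

  firstCycle-followsNext : followsNext 0 (toDate (+ 0)) 146097 ≡ true
  firstCycle-followsNext = refl

toDate-suc-firstCycle : ∀ t → t ℕ.< 146097 → toDate (+ ℕ.suc t) ≡ next (toDate (+ t))
toDate-suc-firstCycle t t<P = subst (λ n → toDate (+ ℕ.suc n) ≡ next (toDate (+ n))) (ℕP.+-identityʳ t)
  (followsNext-sound 146097 0 firstCycle-followsNext t t<P)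

toDate-suc : ∀ n → toDate (+ ℕ.suc n) ≡ next (toDate (+ n))
toDate-suc n = begin
  toDate (+ ℕ.suc n)                   ≡⟨ cong (λ m → toDate (+ ℕ.suc m)) n≡t+cP ⟩
  toDate (+ (ℕ.suc t ℕ.+ c ℕ.* 146097)) ≡⟨ toDate-ℕ-period (ℕ.suc t) c ⟩
  addYears s (toDate (+ ℕ.suc t))      ≡⟨ cong (addYears s) (toDate-suc-firstCycle t (ℕD.m%n<n n 146097)) ⟩
  addYears s (next (toDate (+ t)))     ≡⟨ next-addYears s (isLeap-+-*400 (+ c)) (toDate (+ t)) ⟨
  next (addYears s (toDate (+ t)))     ≡⟨ cong next (toDate-ℕ-period t c) ⟨
  next (toDate (+ (t ℕ.+ c ℕ.* 146097))) ≡⟨ cong (λ m → next (toDate (+ m))) n≡t+cP ⟨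
  next (toDate (+ n))                  ∎
  where
  open ≡-Reasoning
  t = n ℕ.% 146097
  c = n ℕ./ 146097
  s = + c * + 400
  n≡t+cP : n ≡ t ℕ.+ c ℕ.* 146097
  n≡t+cP = ℕD.m≡m%n+[m/n]*n n 146097

Fin-↔-unique : ∀ {m n} {A : Set} → Fin m ↔ A → Fin n ↔ A → m ≡ n
Fin-↔-unique πₘ πₙ = ↔⇒≡ (↔-sym πₙ ↔-∘ πₘ)

RataDie-unique : ∀ {C e x r r′} → RataDie C e x r → RataDie C e x r′ → r ≡ r′
RataDie-unique {e = e} {x} (after , before) (after′ , before′) with ≤ₗ∨>ₗ e x
... | inj₁ e≤x with after e≤x | after′ e≤x
...   | n , r≡n , πₙ | n′ , r′≡n′ , πₙ′ = trans r≡n (trans (cong (+_) (Fin-↔-unique πₙ πₙ′)) (sym r′≡n′))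
RataDie-unique {e = e} {x} (after , before) (after′ , before′) | inj₂ x<e with before x<e | before′ x<e
...   | n , r≡n , πₙ | n′ , r′≡n′ , πₙ′ = trans r≡n (trans (cong (-_ ∘ +_) (Fin-↔-unique πₙ πₙ′)) (sym r′≡n′))

module Enumeration
  (C : Date → Set) (C-irrelevant : ∀ {x} (p q : C x) → p ≡ q)
  (f : ℕ → Date)
  (f-C : ∀ n → C (f n))
  (f-< : ∀ n → f n <ₗ f (ℕ.suc n))
  (f-gapless : ∀ n {w} → C w → f n <ₗ w → f (ℕ.suc n) ≤ₗ w)
  (f-unbounded : ∀ w → Σ ℕ λ N → w <ₗ f N)
  where

  f-strictMono : ∀ {a b} → a ℕ.< b → f a <ₗ f b
  f-strictMono {a} {ℕ.suc b} a<1+b with ℕP.m<1+n⇒m<n∨m≡n a<1+b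
  ... | inj₁ a<b = <ₗ-trans (f-strictMono a<b) (f-< b)
  ... | inj₂ refl = f-< a

  f-mono : ∀ {a b} → a ℕ.≤ b → f a ≤ₗ f b
  f-mono a≤b with ℕP.m≤n⇒m<n∨m≡n a≤b
  ... | inj₁ a<b = inj₁ (f-strictMono a<b)
  ... | inj₂ refl = inj₂ refl

  f-cancel-< : ∀ {a b} → f a <ₗ f b → a ℕ.< b
  f-cancel-< {a} {b} fa<fb = ℕP.≰⇒> (λ b≤a → <ₗ-irrefl (<ₗ-≤ₗ-trans fa<fb (f-mono b≤a)))

  f-cancel-≤ : ∀ {a b} → f a ≤ₗ f b → a ℕ.≤ b
  f-cancel-≤ {a} {b} fa≤fb = ℕP.≮⇒≥ (λ b<a → <ₗ-irrefl (≤ₗ-<ₗ-trans fa≤fb (f-strictMono b<a)))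

  f-injective : ∀ {a b} → f a ≡ f b → a ≡ b
  f-injective fa≡fb = ℕP.≤-antisym (f-cancel-≤ (inj₂ fa≡fb)) (f-cancel-≤ (inj₂ (sym fa≡fb)))

  f-surjective : ∀ {w} → C w → f 0 ≤ₗ w → Σ ℕ λ n → f n ≡ w
  f-surjective {w} w∈C f0≤w = below (proj₁ (f-unbounded w)) (proj₂ (f-unbounded w))
    where
    below : ∀ N → w <ₗ f N → Σ ℕ λ n → f n ≡ w
    below ℕ.zero w<f0 = ⊥-elim (<ₗ-irrefl (≤ₗ-<ₗ-trans f0≤w w<f0))
    below (ℕ.suc N) w<f[N+1] with ≤ₗ∨>ₗ (f N) w
    ... | inj₂ w<fN = below N w<fN
    ... | inj₁ (inj₂ fN≡w) = N , fN≡w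
    ... | inj₁ (inj₁ fN<w) = ⊥-elim (<ₗ-irrefl (<ₗ-≤ₗ-trans w<f[N+1] (f-gapless N w∈C fN<w)))

  Between : ℕ → ℕ → Date → Set
  Between a b w = C w × f a ≤ₗ w × w <ₗ f b

  Between-irrelevant : ∀ {a b w} (p q : Between a b w) → p ≡ q
  Between-irrelevant (c , fa≤w , w<fb) (c′ , fa≤w′ , w<fb′) =
    cong₂ _,_ (C-irrelevant c c′) (cong₂ _,_ (≤ₗ-irrelevant fa≤w fa≤w′) (<ₗ-irrelevant w<fb w<fb′))

  Between-≡ : ∀ {a b w w′} {p : Between a b w} {q : Between a b w′} →
    w ≡ w′ → _≡_ {A = Σ Date (Between a b)} (w , p) (w′ , q)
  Between-≡ refl = cong (_ ,_) (Between-irrelevant _ _)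

  Fin↔Between : ∀ {a b} → a ℕ.≤ b → Fin (b ℕ.∸ a) ↔ Σ Date (Between a b)
  Fin↔Between {a} {b} a≤b = mk↔ₛ′ to from to∘from from∘to
    where
    index : Σ Date (Between a b) → ℕ
    index (_ , c , fa≤w , _) = proj₁ (f-surjective c (≤ₗ-trans (f-mono z≤n) fa≤w))
    f-index : ∀ p → f (index p) ≡ proj₁ p
    f-index (_ , c , fa≤w , _) = proj₂ (f-surjective c (≤ₗ-trans (f-mono z≤n) fa≤w))
    a≤index : ∀ p → a ℕ.≤ index p
    a≤index p@(_ , _ , fa≤w , _) = f-cancel-≤ (subst (f a ≤ₗ_) (sym (f-index p)) fa≤w)
    index<b : ∀ p → index p ℕ.< b
    index<b p@(_ , _ , _ , w<fb) = f-cancel-< (subst (_<ₗ f b) (sym (f-index p)) w<fb)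
    offset<b-a : ∀ p → index p ℕ.∸ a ℕ.< b ℕ.∸ a
    offset<b-a p = ℕP.∸-monoˡ-< (index<b p) (a≤index p)
    a+i<b : ∀ (i : Fin (b ℕ.∸ a)) → a ℕ.+ toℕ i ℕ.< b
    a+i<b i = subst (a ℕ.+ toℕ i ℕ.<_) (ℕP.m+[n∸m]≡n a≤b) (ℕP.+-monoʳ-< a (FinP.toℕ<n i))
    to : Fin (b ℕ.∸ a) → Σ Date (Between a b)
    to i = f (a ℕ.+ toℕ i) , f-C (a ℕ.+ toℕ i) , f-mono (ℕP.m≤m+n a (toℕ i)) , f-strictMono (a+i<b i)
    from : Σ Date (Between a b) → Fin (b ℕ.∸ a)
    from p = fromℕ< (offset<b-a p)
    to∘from : ∀ p → to (from p) ≡ p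
    to∘from p@(w , _) = Between-≡ (begin
      f (a ℕ.+ toℕ (from p))       ≡⟨ cong (λ i → f (a ℕ.+ i)) (FinP.toℕ-fromℕ< (offset<b-a p)) ⟩
      f (a ℕ.+ (index p ℕ.∸ a))    ≡⟨ cong f (ℕP.m+[n∸m]≡n (a≤index p)) ⟩
      f (index p)                   ≡⟨ f-index p ⟩
      w                             ∎)
      where open ≡-Reasoning
    from∘to : ∀ i → from (to i) ≡ i
    from∘to i = FinP.toℕ-injective (begin
      toℕ (from (to i))           ≡⟨ FinP.toℕ-fromℕ< (offset<b-a (to i)) ⟩
      index (to i) ℕ.∸ a          ≡⟨ cong (ℕ._∸ a) (f-injective (f-index (to i))) ⟩
      a ℕ.+ toℕ i ℕ.∸ a           ≡⟨ ℕP.m+n∸m≡n a (toℕ i) ⟩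
      toℕ i                       ∎)
      where open ≡-Reasoning

  rataDie : ∀ j n → RataDie C (f j) (f n) (+ n - + j)
  rataDie j n = after , before
    where
    after : f j ≤ₗ f n → Σ ℕ λ m → (+ n - + j ≡ + m) × (Fin m ↔ Σ Date (Between j n))
    after fj≤fn = n ℕ.∸ j , trans (ℤP.m-n≡m⊖n n j) (ℤP.⊖-≥ j≤n) , Fin↔Between j≤n
      where j≤n = f-cancel-≤ fj≤fn
    before : f n <ₗ f j → Σ ℕ λ m → (+ n - + j ≡ - + m) × (Fin m ↔ Σ Date (Between n j))
    before fn<fj = j ℕ.∸ n , trans (ℤP.m-n≡m⊖n n j) (ℤP.⊖-< n<j) , Fin↔Between (ℕP.<⇒≤ n<j)
      where n<j = f-cancel-< fn<fj

  rataDie-rebase : ∀ {e k} → C e → f 0 ≤ₗ e → RataDie C (f 0) e k → ∀ n → RataDie C e (f n) (+ n - k)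
  rataDie-rebase e∈C f0≤e ρ[e]≡k n with f-surjective e∈C f0≤e
  ... | j , refl = subst (λ k → RataDie C (f j) (f n) (+ n - k)) j≡k (rataDie j n)
    where
    j≡k : + j ≡ _
    j≡k = trans (sym (ℤP.+-identityʳ (+ j))) (RataDie-unique (rataDie 0 j) ρ[e]≡k)

i≤+∣i∣ : ∀ i → i ≤ + ∣ i ∣
i≤+∣i∣ (+ _) = ℤP.≤-refl
i≤+∣i∣ -[1+ _ ] = -≤+

module G₂-Enumeration (z : ℤ) (400∣z : + 400 ∣ z) where

  nthDay : ℕ → Date
  nthDay n = addYears z (toDate (+ n))

  nthDay-0 : nthDay 0 ≡ e₂ z
  nthDay-0 = trans (cong (addYears z) toDate-0) (cong (_, + 3 , + 1) (ℤP.+-identityˡ z))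

  nthDay-suc : ∀ n → nthDay (ℕ.suc n) ≡ next (nthDay n)
  nthDay-suc n =
    trans (cong (addYears z) (toDate-suc n)) (sym (next-addYears z (isLeap-+-400∣ 400∣z) (toDate (+ n))))

  nthDay-G₂ : ∀ n → G₂ z (nthDay n)
  nthDay-G₂ ℕ.zero = subst (G₂ z) (sym nthDay-0) (e₂∈G , inj₂ refl)
    where
    e₂∈G : InG (e₂ z)
    e₂∈G = (+≤+ (s≤s z≤n) , +≤+ (s≤s (s≤s (s≤s z≤n)))) , (ℤP.≤-refl , +≤+ (s≤s z≤n))
  nthDay-G₂ (ℕ.suc n) with nthDay-G₂ n
  ... | x∈G , e₂≤x = subst (G₂ z) (sym (nthDay-suc n)) (next-InG x∈G , ≤ₗ-trans e₂≤x (inj₁ (<ₗ-next (nthDay n))))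

  nthDay-< : ∀ n → nthDay n <ₗ nthDay (ℕ.suc n)
  nthDay-< n = subst (nthDay n <ₗ_) (sym (nthDay-suc n)) (<ₗ-next (nthDay n))

  nthDay-gapless : ∀ n {w} → G₂ z w → nthDay n <ₗ w → nthDay (ℕ.suc n) ≤ₗ w
  nthDay-gapless n (w∈G , _) nthDay<w = subst (_≤ₗ _) (sym (nthDay-suc n)) (next-minimal w∈G nthDay<w)

  nthDay-unbounded : ∀ w → Σ ℕ λ N → w <ₗ nthDay N
  nthDay-unbounded (y , _ , _) = c ℕ.* 146097 , subst (_ <ₗ_) (sym nthDay-c*146097) (inj₁ y<)
    where
    u = ∣ y - z ∣
    c = ℕ.suc u
    nthDay-c*146097 : nthDay (c ℕ.* 146097) ≡ (+ 0 + + c * + 400 + z , + 3 , + 1)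
    nthDay-c*146097 = cong (addYears z) (trans (toDate-ℕ-period 0 c) (cong (addYears (+ c * + 400)) toDate-0))
    y< : y < + 0 + + c * + 400 + z
    y< = begin-strict
      y                      ≡⟨ y≡y-z+z y z ⟩
      y - z + z              ≤⟨ ℤP.+-monoˡ-≤ z (i≤+∣i∣ (y - z)) ⟩
      + u + z                <⟨ ℤP.+-monoˡ-< z (+<+ (ℕP.m≤m*n c 400)) ⟩
      + (c ℕ.* 400) + z      ≡⟨ cong (_+ z) (trans (ℤP.pos-* c 400) (sym (ℤP.+-identityˡ _))) ⟩
      + 0 + + c * + 400 + z  ∎
      where
      open ℤP.≤-Reasoning
      y≡y-z+z : ∀ y z → y ≡ y - z + z
      y≡y-z+z = solve-∀

  open Enumeration (G₂ z) (G₂-irrelevant z) nthDay nthDay-G₂ nthDay-< nthDay-gapless nthDay-unbounded public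

  toDate-correct : ∀ {e₃ k} → G₂ z e₃ → e₂ z ≤ₗ e₃ → RataDie (G₂ z) (e₂ z) e₃ k → ∀ r → - k ≤ r →
    G₂ z (addYears z (toDate (r + k))) × RataDie (G₂ z) e₃ (addYears z (toDate (r + k))) r
  toDate-correct {e₃} {k} e₃∈G₂ e₂≤e₃ ρ₂[e₃]≡k r -k≤r =
    subst (λ x → G₂ z x × RataDie (G₂ z) e₃ x r) (cong (addYears z ∘ toDate) n₀≡r+k)
      (nthDay-G₂ n₀ , subst (RataDie (G₂ z) e₃ (nthDay n₀)) n₀-k≡r (rataDie-rebase e₃∈G₂ nthDay0≤e₃ ρ₀[e₃]≡k n₀))
    where
    nthDay0≤e₃ : nthDay 0 ≤ₗ e₃
    nthDay0≤e₃ = subst (_≤ₗ e₃) (sym nthDay-0) e₂≤e₃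
    ρ₀[e₃]≡k : RataDie (G₂ z) (nthDay 0) e₃ k
    ρ₀[e₃]≡k = subst (λ e → RataDie (G₂ z) e e₃ k) (sym nthDay-0) ρ₂[e₃]≡k
    n₀ = ∣ r + k ∣
    n₀≡r+k : + n₀ ≡ r + k
    n₀≡r+k = ℤP.0≤i⇒+∣i∣≡i (subst (_≤ r + k) (ℤP.+-inverseˡ k) (ℤP.+-monoˡ-≤ k -k≤r))
    r+k-k≡r : ∀ r k → r + k - k ≡ r
    r+k-k≡r = solve-∀
    n₀-k≡r : + n₀ - k ≡ r
    n₀-k≡r = trans (cong (_- k) n₀≡r+k) (r+k-k≡r r k)

-- Once fromCentury is unfolded, the statement's date is definitionally addYears z₂ (toDate (r + k)).
opaque
  unfolding fromCentury

  proposition7 :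
    (z₂ : ℤ) → (+ 400) ∣ z₂ →
    (e₃ : Date) → G₂ z₂ e₃ → e₂ z₂ ≤ₗ e₃ →
    (k : ℤ) → RataDie (G₂ z₂) (e₂ z₂) e₃ k →
    (r : ℤ) → - k ≤ r →
    let r₀ = r + k
        n₁ = + 4 * r₀ + + 3
        q₁ = n₁ quot (+ 146097)
        r₁ = n₁ rem (+ 146097) quot (+ 4)
        n₂ = + 4 * r₁ + + 3
        u₂ = + 2939745 * n₂
        q₂ = u₂ quot (+ 4294967296)
        r₂ = u₂ rem (+ 4294967296) quot (+ 2939745) quot (+ 4)
        n₃ = + 2141 * r₂ + + 197913
        q₃ = n₃ quot (+ 65536)
        r₃ = n₃ rem (+ 65536) quot (+ 2141)
        y₀ = + 100 * q₁ + q₂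
        m₀ = q₃
        d₀ = r₃
        y₁ = y₀ + 𝟙≤ (+ 306) r₂
        m₁ = m₀ - + 12 * 𝟙≤ (+ 306) r₂
        d₁ = d₀ + + 1
        y₂ = y₁ + z₂
        m₂ = m₁
        d₂ = d₁
    in G₂ z₂ (y₂ , m₂ , d₂) × RataDie (G₂ z₂) e₃ (y₂ , m₂ , d₂) r
  proposition7 z₂ 400∣z₂ e₃ e₃∈G₂ e₂≤e₃ k ρ₂[e₃]≡k = G₂-Enumeration.toDate-correct z₂ 400∣z₂ e₃∈G₂ e₂≤e₃ ρ₂[e₃]≡k
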